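{- There exists a deterministic two-party communication protocol that, given an $n$-vertex graph $G$ (with Alice holding edge set $E_A$ and Bob holding edge set $E_B$, disjoint, on a common vertex set $V$ known to both, $G=(V,E_A\cup E_B)$), computes the degeneracy $\kappa(G)$ using $O(n\log^3 n)$ bits of communication. Moreover, the protocol outputs a $\kappa(G)$-ordering of the vertices of $G$ and a $\kappa(G)$-core of $G$.
   Context: For an undirected graph $G=(V,E)$ and integer $k\ge1$, a $k$-core is a maximal set $S\subseteq V$ such that $G[S]$ has minimum degree at least $k$; the degeneracy $\kappa(G)$ is the largest $k\ge0$ such that $G$ contains a non-empty $k$-core. For an ordering $\sigma$ of $V$, $\mathrm{odeg}_\sigma(v)$ is the number of neighbors of $v$ appearing after $v$ in $\sigma$; $\sigma$ is a $k$-ordering if $\mathrm{odeg}_\sigma(v)\le k$ for all $v\in V$. -}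

module Defs where

open import Data.Nat using (ℕ; zero; suc; _≤_; _⊔_)
open import Data.Bool using (Bool; true; false; _∨_; _∧_; if_then_else_)
open import Data.Fin using (Fin; _<?_)
open import Data.Fin.Subset using (Subset; _∈_; _⊆_; _∩_; ∣_∣; Nonempty)
open import Data.Fin.Permutation using (Permutation′; _⟨$⟩ʳ_)
open import Data.Vec using (tabulate)
open import Data.Product using (_×_; _,_; ∃)
open import Data.Sum using (_⊎_)
open import Relation.Nullary.Decidable using (⌊_⌋)
open import Relation.Binary.PropositionalEquality using (_≡_; refl; cong₂)

record Graph (n : ℕ) : Set where
  field
    adj    : Fin n → Fin n → Bool
    sym    : ∀ u v → adj u v ≡ adj v u
    irrefl : ∀ v → adj v v ≡ false
open Graph public

Disjoint : ∀ {n} → Graph n → Graph n → Set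
Disjoint A B = ∀ u v → adj A u v ≡ true → adj B u v ≡ false

private
  ∨-false : ∀ {a b} → a ≡ false → b ≡ false → (a ∨ b) ≡ false
  ∨-false refl refl = refl

_∪G_ : ∀ {n} → Graph n → Graph n → Graph n
A ∪G B = record
  { adj    = λ u v → adj A u v ∨ adj B u v
  ; sym    = λ u v → cong₂ _∨_ (sym A u v) (sym B u v)
  ; irrefl = λ v → ∨-false (irrefl A v) (irrefl B v)
  }

neighbours : ∀ {n} → Graph n → Fin n → Subset n
neighbours G v = tabulate (adj G v)

degIn : ∀ {n} → Graph n → Subset n → Fin n → ℕ
degIn G S v = ∣ S ∩ neighbours G v ∣

MinDegAtLeast : ∀ {n} → Graph n → ℕ → Subset n → Set
MinDegAtLeast G k S = ∀ v → v ∈ S → k ≤ degIn G S v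

IsCore : ∀ {n} → Graph n → ℕ → Subset n → Set
IsCore G k S = MinDegAtLeast G k S
             × (∀ T → MinDegAtLeast G k T → S ⊆ T → T ⊆ S)

HasNonemptyCore : ∀ {n} → Graph n → ℕ → Set
HasNonemptyCore G k = ∃ λ S → IsCore G k S × Nonempty S

-- κ is the degeneracy: the largest k ≥ 0 with a non-empty k-core
-- (for the empty vertex set, where no non-empty core exists, κ = 0)
IsDegeneracy : ∀ {n} → Graph n → ℕ → Set
IsDegeneracy G κ = (HasNonemptyCore G κ ⊎ κ ≡ 0)
                 × (∀ k → HasNonemptyCore G k → k ≤ κ)

-- Orderings: σ maps each vertex to its position in the ordering

odeg : ∀ {n} → Graph n → Permutation′ n → Fin n → ℕ
odeg G σ v = ∣ tabulate (λ u → adj G v u ∧ ⌊ (σ ⟨$⟩ʳ v) <? (σ ⟨$⟩ʳ u) ⌋) ∣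

IsKOrdering : ∀ {n} → Graph n → ℕ → Permutation′ n → Set
IsKOrdering G k σ = ∀ v → odeg G σ v ≤ k

-- Deterministic two-party communication protocols (protocol trees). At an internal node the owning
-- party sends one bit computed from its own input (the history is the
-- position in the tree); leaves carry the common output.

data Protocol (X Y O : Set) : Set where
  leaf  : O → Protocol X Y O
  alice : (X → Bool) → (false-branch true-branch : Protocol X Y O) → Protocol X Y O
  bob   : (Y → Bool) → (false-branch true-branch : Protocol X Y O) → Protocol X Y O

run : ∀ {X Y O} → Protocol X Y O → X → Y → O
run (leaf o)      x y = o
run (alice f p q) x y = if f x then run q x y else run p x y
run (bob g p q)   x y = if g y then run q x y else run p x y

-- worst-case number of bits communicated = depth of the protocol tree
cost : ∀ {X Y O} → Protocol X Y O → ℕ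
cost (leaf o)      = 0
cost (alice f p q) = suc (cost p ⊔ cost q)
cost (bob g p q)   = suc (cost p ⊔ cost q)

Output : ℕ → Set
Output n = ℕ × Permutation′ n × Subset n

Correct : ∀ n → Graph n → Graph n → Output n → Set
Correct n A B (κ , σ , S) =
  IsDegeneracy (A ∪G B) κ × IsKOrdering (A ∪G B) κ σ × IsCore (A ∪G B) κ S

{-# OPTIONS --safe #-}
-- The protocol simulates the peeling algorithm with a threshold k: a remaining vertex whose
-- degree into the remaining set is at most k is removed and takes the next position of the
-- ordering; when there is none, the remaining vertices induce minimum degree above k, so they
-- form the (k+1)-core and k is raised. Alice and Bob keep common upper estimates a(v) ≥ d_A(v)
-- and b(v) ≥ d_B(v) of their degrees into the remaining set and peel v silently once
-- a(v) + b(v) ≤ k. Otherwise a party whose true degree has fallen by at least half of the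
-- slack a(v) + b(v) − k announces v and both send their exact degrees, which halves the slack
-- of v; since the slack never exceeds 2n, each vertex is resynchronised O(log n) times. If
-- neither party announces, d_A(v) + d_B(v) > k for every remaining v, which justifies raising
-- k. The potential Σ_v (O(log n) − resyncs of v) + (n − k) drops in every round, so there are
-- O(n log n) rounds of O(log n) bits each.
module Submission where

open import Defs hiding (sym)
open import Data.Bool using (Bool; true; _∨_; _∧_; if_then_else_)
open import Data.Bool.Properties using (∧-conicalˡ; ∧-conicalʳ)
open import Data.Fin using (Fin; zero; suc; toℕ; fromℕ<; _<?_) renaming (_<_ to _<ᶠ_)
open import Data.Fin.Properties using (toℕ<n; toℕ-fromℕ<; toℕ-injective; any?) renaming (_≟_ to _≟ᶠ_)
open import Data.Fin.Permutation using (Permutation′; _⟨$⟩ʳ_; _⟨$⟩ˡ_; _∘ₚ_; inverseˡ; transpose) renaming (id to idₚ)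
import Data.Fin.Permutation.Components as PC
open import Data.Fin.Subset using (Subset; inside; outside; _∈_; _∉_; _⊆_; _∩_; _∪_; ∣_∣; Nonempty; Empty; ⊤; ⊥)
open import Data.Fin.Subset.Properties using (p⊆q⇒∣p∣≤∣q∣; ∣p∣≤n; ⊆⊤; drop-∷-Empty; x∈p∩q⁺; x∈p∩q⁻; ∩-distribˡ-∪; _∈?_; nonempty?)
open import Data.Nat using (ℕ; zero; suc; _+_; _*_; _∸_; _^_; _≤_; _<_; _≤?_; z≤n; s≤s; s≤s⁻¹; z<s; _⊔_; ⌊_/2⌋; ⌈_/2⌉; NonZero; >-nonZero)
open import Data.Nat.Logarithm using (⌈log₂_⌉; ⌈log₂⌉-mono-≤; ⌈log₂⌈n/2⌉⌉≡⌈log₂n⌉∸1)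
open import Data.Nat.Properties hiding (_<?_; _≟_)
open import Data.Nat.Induction using (<-rec)
open import Data.Nat.Tactic.RingSolver using (solve-∀)
open import Data.Maybe as Maybe using (Maybe; just; nothing)
open import Data.Product using (Σ; _×_; _,_; proj₁; proj₂; ∃)
open import Data.Sum using (_⊎_; inj₁; inj₂)
open import Data.Vec using ([]; _∷_; tabulate; here)
open import Data.Vec.Functional using (updateAt)
open import Data.Vec.Functional.Properties using (updateAt-updates; updateAt-minimal)
open import Data.Vec.Properties using (lookup∘tabulate; lookup⇒[]=; []=⇒lookup; tabulate-cong)
open import Function using (_∘_; const; id)
open import Relation.Nullary using (¬_; Dec; yes; no; does; contradiction)
open import Relation.Nullary.Decidable using (⌊_⌋; dec-true; dec-false; dec⇒maybe; _×-dec_)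
open import Relation.Binary.PropositionalEquality using (_≡_; _≢_; refl; sym; trans; cong; subst; subst₂; module ≡-Reasoning)

open import Algebra.Properties.Monoid.Sum +-0-monoid using (sum)

sum-mono-≤ : ∀ {m} {f g : Fin m → ℕ} → (∀ i → f i ≤ g i) → sum f ≤ sum g
sum-mono-≤ {zero}  f≤g = z≤n
sum-mono-≤ {suc m} f≤g = +-mono-≤ (f≤g zero) (sum-mono-≤ (f≤g ∘ suc))

sum-mono-< : ∀ {m} {f g : Fin m → ℕ} → (∀ i → f i ≤ g i) → ∀ j → f j < g j → sum f < sum g
sum-mono-< f≤g zero    fj<gj = +-mono-<-≤ fj<gj (sum-mono-≤ (f≤g ∘ suc))
sum-mono-< f≤g (suc j) fj<gj = +-mono-≤-< (f≤g zero) (sum-mono-< (f≤g ∘ suc) j fj<gj)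

sum≤m*b : ∀ {m b} {f : Fin m → ℕ} → (∀ i → f i ≤ b) → sum f ≤ m * b
sum≤m*b {zero}  f≤b = z≤n
sum≤m*b {suc m} f≤b = +-mono-≤ (f≤b zero) (sum≤m*b (f≤b ∘ suc))

∈-tabulate⁺ : ∀ {m} {f : Fin m → Bool} {x} → f x ≡ true → x ∈ tabulate f
∈-tabulate⁺ {f = f} {x} fx = lookup⇒[]= x (tabulate f) (trans (lookup∘tabulate f x) fx)

∈-tabulate⁻ : ∀ {m} {f : Fin m → Bool} {x} → x ∈ tabulate f → f x ≡ true
∈-tabulate⁻ {f = f} {x} x∈ = trans (sym (lookup∘tabulate f x)) ([]=⇒lookup x∈)

⌊⌋≡true⁺ : ∀ {Q : Set} (Q? : Dec Q) → Q → ⌊ Q? ⌋ ≡ true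
⌊⌋≡true⁺ (yes _) _ = refl
⌊⌋≡true⁺ (no ¬q) q = contradiction q ¬q

⌊⌋≡true⁻ : ∀ {Q : Set} (Q? : Dec Q) → ⌊ Q? ⌋ ≡ true → Q
⌊⌋≡true⁻ (yes q) _ = q

module _ {m} {P : Fin m → Set} (P? : ∀ x → Dec (P x)) where

  ∈-tabulate-⌊⌋⁺ : ∀ {x} → P x → x ∈ tabulate (⌊_⌋ ∘ P?)
  ∈-tabulate-⌊⌋⁺ {x} = ∈-tabulate⁺ ∘ ⌊⌋≡true⁺ (P? x)

  ∈-tabulate-⌊⌋⁻ : ∀ {x} → x ∈ tabulate (⌊_⌋ ∘ P?) → P x
  ∈-tabulate-⌊⌋⁻ {x} = ⌊⌋≡true⁻ (P? x) ∘ ∈-tabulate⁻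

∣p∪q∣≡∣p∣+∣q∣ : ∀ {m} (p q : Subset m) → Empty (p ∩ q) → ∣ p ∪ q ∣ ≡ ∣ p ∣ + ∣ q ∣
∣p∪q∣≡∣p∣+∣q∣ []            []            _  = refl
∣p∪q∣≡∣p∣+∣q∣ (inside ∷ p)  (inside ∷ q)  pq = contradiction (zero , here) pq
∣p∪q∣≡∣p∣+∣q∣ (inside ∷ p)  (outside ∷ q) pq = cong suc (∣p∪q∣≡∣p∣+∣q∣ p q (drop-∷-Empty pq))
∣p∪q∣≡∣p∣+∣q∣ (outside ∷ p) (inside ∷ q)  pq =
  trans (cong suc (∣p∪q∣≡∣p∣+∣q∣ p q (drop-∷-Empty pq))) (sym (+-suc ∣ p ∣ ∣ q ∣))
∣p∪q∣≡∣p∣+∣q∣ (outside ∷ p) (outside ∷ q) pq = ∣p∪q∣≡∣p∣+∣q∣ p q (drop-∷-Empty pq)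

tabulate-∨ : ∀ {m} (f g : Fin m → Bool) → tabulate (λ u → f u ∨ g u) ≡ tabulate f ∪ tabulate g
tabulate-∨ {zero}  f g = refl
tabulate-∨ {suc m} f g = cong ((f zero ∨ g zero) ∷_) (tabulate-∨ (f ∘ suc) (g ∘ suc))

-- Degrees and cores

module _ {n} (G : Graph n) where

  degIn-mono : ∀ {S T} → S ⊆ T → ∀ v → degIn G S v ≤ degIn G T v
  degIn-mono S⊆T v = p⊆q⇒∣p∣≤∣q∣ λ x∈ →
    let x∈S , x∈N = x∈p∩q⁻ _ _ x∈ in x∈p∩q⁺ (S⊆T x∈S , x∈N)

  degIn≤n : ∀ S v → degIn G S v ≤ n
  degIn≤n S v = ∣p∣≤n (S ∩ neighbours G v)

  MinDegAtLeast-weaken : ∀ {k k′ S} → k ≤ k′ → MinDegAtLeast G k′ S → MinDegAtLeast G k S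
  MinDegAtLeast-weaken k≤k′ dense v v∈ = ≤-trans k≤k′ (dense v v∈)

  lowDegree∉dense : ∀ {k S T w} → MinDegAtLeast G (suc k) T → T ⊆ S → degIn G S w ≤ k → w ∉ T
  lowDegree∉dense dense T⊆S low w∈T = <⇒≱ (≤-trans (dense _ w∈T) (degIn-mono T⊆S _)) low

  degeneracy-certificate : ∀ {k S} → MinDegAtLeast G k S → (∀ T → MinDegAtLeast G k T → T ⊆ S) →
                           (∀ T → MinDegAtLeast G (suc k) T → Empty T) → k ≡ 0 ⊎ Nonempty S →
                           IsDegeneracy G k × IsCore G k S
  degeneracy-certificate {k} {S} dense maximum sparse k≡0⊎S≢∅ = (attained k≡0⊎S≢∅ , bounded) , core
    where
    core : IsCore G k S
    core = dense , λ T T-dense _ → maximum T T-dense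

    attained : k ≡ 0 ⊎ Nonempty S → HasNonemptyCore G k ⊎ k ≡ 0
    attained (inj₁ k≡0) = inj₂ k≡0
    attained (inj₂ S≢∅) = inj₁ (S , core , S≢∅)

    bounded : ∀ k′ → HasNonemptyCore G k′ → k′ ≤ k
    bounded k′ (T , (T-dense , _) , T≢∅) with k′ ≤? k
    ... | yes k′≤k = k′≤k
    ... | no  k′≰k = contradiction T≢∅ (sparse T (MinDegAtLeast-weaken (≰⇒> k′≰k) T-dense))

degIn-∪G : ∀ {n} {A B : Graph n} → Disjoint A B → ∀ S v → degIn (A ∪G B) S v ≡ degIn A S v + degIn B S v
degIn-∪G {A = A} {B} disjoint S v = begin
  ∣ S ∩ tabulate (λ u → adj A v u ∨ adj B v u) ∣ ≡⟨ cong (λ N → ∣ S ∩ N ∣) (tabulate-∨ (adj A v) (adj B v)) ⟩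
  ∣ S ∩ (NA ∪ NB) ∣                              ≡⟨ cong ∣_∣ (∩-distribˡ-∪ S NA NB) ⟩
  ∣ (S ∩ NA) ∪ (S ∩ NB) ∣                        ≡⟨ ∣p∪q∣≡∣p∣+∣q∣ (S ∩ NA) (S ∩ NB) no-common-neighbour ⟩
  ∣ S ∩ NA ∣ + ∣ S ∩ NB ∣                        ∎
  where
  open ≡-Reasoning
  NA NB : Subset _
  NA = neighbours A v
  NB = neighbours B v
  no-common-neighbour : Empty ((S ∩ NA) ∩ (S ∩ NB))
  no-common-neighbour (u , u∈) =
    let u∈SNA , u∈SNB = x∈p∩q⁻ _ _ u∈
        uvA = ∈-tabulate⁻ (proj₂ (x∈p∩q⁻ S NA u∈SNA))
        uvB = ∈-tabulate⁻ (proj₂ (x∈p∩q⁻ S NB u∈SNB))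
    in contradiction (trans (sym (disjoint v u uvA)) uvB) λ ()

⟨$⟩ʳ-injective : ∀ {m} (π : Permutation′ m) {x y} → π ⟨$⟩ʳ x ≡ π ⟨$⟩ʳ y → x ≡ y
⟨$⟩ʳ-injective π πx≡πy = trans (sym (inverseˡ π)) (trans (cong (π ⟨$⟩ˡ_) πx≡πy) (inverseˡ π))

module _ {m} (i j : Fin m) where

  transpose-i : PC.transpose i j i ≡ j
  transpose-i rewrite dec-true (i ≟ᶠ i) refl = refl

  transpose-j : PC.transpose i j j ≡ i
  transpose-j = by-cases (j ≟ᶠ i)
    where
    by-cases : Dec (j ≡ i) → PC.transpose i j j ≡ i
    by-cases (yes j≡i) rewrite dec-true (j ≟ᶠ i) j≡i = j≡i
    by-cases (no  j≢i) rewrite dec-false (j ≟ᶠ i) j≢i | dec-true (j ≟ᶠ j) refl = refl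

  transpose-fixes : ∀ {k} → k ≢ i → k ≢ j → PC.transpose i j k ≡ k
  transpose-fixes {k} k≢i k≢j rewrite dec-false (k ≟ᶠ i) k≢i | dec-false (k ≟ᶠ j) k≢j = refl

  <?-transpose : ∀ {x : Fin m} → x <ᶠ i → x <ᶠ j → ∀ y → ⌊ x <? PC.transpose i j y ⌋ ≡ ⌊ x <? y ⌋
  <?-transpose {x} x<i x<j y = by-cases (y ≟ᶠ i) (y ≟ᶠ j)
    where
    by-cases : Dec (y ≡ i) → Dec (y ≡ j) → ⌊ x <? PC.transpose i j y ⌋ ≡ ⌊ x <? y ⌋
    by-cases (yes refl) _ = trans (cong (⌊_⌋ ∘ (x <?_)) transpose-i)
                                  (trans (⌊⌋≡true⁺ (x <? j) x<j) (sym (⌊⌋≡true⁺ (x <? i) x<i)))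
    by-cases (no _) (yes refl) = trans (cong (⌊_⌋ ∘ (x <?_)) transpose-j)
                                       (trans (⌊⌋≡true⁺ (x <? i) x<i) (sym (⌊⌋≡true⁺ (x <? j) x<j)))
    by-cases (no y≢i) (no y≢j) = cong (⌊_⌋ ∘ (x <?_)) (transpose-fixes y≢i y≢j)

-- Two-party protocols

fromℕ? : ∀ {m} → ℕ → Maybe (Fin m)
fromℕ? {zero}  _       = nothing
fromℕ? {suc m} zero    = just zero
fromℕ? {suc m} (suc i) = Maybe.map suc (fromℕ? i)

fromℕ?-toℕ : ∀ {m} (i : Fin m) → fromℕ? (toℕ i) ≡ just i
fromℕ?-toℕ zero    = refl
fromℕ?-toℕ (suc i) = cong (Maybe.map suc) (fromℕ?-toℕ i)

encode : ∀ {m} → Maybe (Fin m) → ℕ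
encode nothing  = 0
encode (just i) = suc (toℕ i)

decode : ∀ {m} → ℕ → Maybe (Fin m)
decode zero    = nothing
decode (suc i) = fromℕ? i

decode∘encode : ∀ {m} (x : Maybe (Fin m)) → decode (encode x) ≡ x
decode∘encode nothing  = refl
decode∘encode (just i) = fromℕ?-toℕ i

encode≤m : ∀ {m} (x : Maybe (Fin m)) → encode x ≤ m
encode≤m nothing  = z≤n
encode≤m (just i) = toℕ<n i

data Party : Set where
  Alice Bob : Party

module Messages {X Y O : Set} where

  Input : Party → Set
  Input Alice = X
  Input Bob   = Y

  input : (p : Party) → X → Y → Input p
  input Alice x y = x
  input Bob   x y = y

  tell : (p : Party) → (Input p → Bool) → (if-false if-true : Protocol X Y O) → Protocol X Y O
  tell Alice = alice
  tell Bob   = bob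

  run-tell : ∀ p f q₀ q₁ x y → run (tell p f q₀ q₁) x y ≡ (if f (input p x y) then run q₁ x y else run q₀ x y)
  run-tell Alice f q₀ q₁ x y = refl
  run-tell Bob   f q₀ q₁ x y = refl

  cost-tell : ∀ p f q₀ q₁ → cost (tell p f q₀ q₁) ≡ suc (cost q₀ ⊔ cost q₁)
  cost-tell Alice f q₀ q₁ = refl
  cost-tell Bob   f q₀ q₁ = refl

  send : (p : Party) → ℕ → (Input p → ℕ) → (ℕ → Protocol X Y O) → Protocol X Y O
  send p zero    f k = k 0
  send p (suc b) f k =
    tell p (λ z → does (2 ^ b ≤? f z)) (send p b f k) (send p b (λ z → f z ∸ 2 ^ b) (k ∘ (2 ^ b +_)))

  run-send : ∀ p b f k x y → f (input p x y) < 2 ^ b → run (send p b f k) x y ≡ run (k (f (input p x y))) x y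
  run-send p zero f k x y z<1 = cong (λ m → run (k m) x y) (sym (n<1⇒n≡0 z<1))
  run-send p (suc b) f k x y z<2^[1+b] =
    trans (run-tell p _ (send p b f k) (send p b (λ z → f z ∸ 2 ^ b) (k ∘ (2 ^ b +_))) x y) (by-cases (2 ^ b ≤? z))
    where
    z : ℕ
    z = f (input p x y)
    by-cases : (d : Dec (2 ^ b ≤ z)) →
               (if does d then run (send p b (λ z → f z ∸ 2 ^ b) (k ∘ (2 ^ b +_))) x y else run (send p b f k) x y)
               ≡ run (k z) x y
    by-cases (no  z≱2^b) = run-send p b f k x y (≰⇒> z≱2^b)
    by-cases (yes z≥2^b) = trans (run-send p b (λ z → f z ∸ 2 ^ b) (k ∘ (2 ^ b +_)) x y low-bits<2^b)
                                 (cong (λ m → run (k m) x y) (m+[n∸m]≡n z≥2^b))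
      where
      low-bits<2^b : z ∸ 2 ^ b < 2 ^ b
      low-bits<2^b = m<n+o⇒m∸n<o z (2 ^ b) {{m^n≢0 2 b}} (subst (z <_) (cong (2 ^ b +_) (+-identityʳ (2 ^ b))) z<2^[1+b])

  cost-send : ∀ p b f k {c} → (∀ m → cost (k m) ≤ c) → cost (send p b f k) ≤ b + c
  cost-send p zero    f k k≤c = k≤c 0
  cost-send p (suc b) f k k≤c rewrite cost-tell p (λ z → does (2 ^ b ≤? f z)) (send p b f k)
              (send p b (λ z → f z ∸ 2 ^ b) (k ∘ (2 ^ b +_))) =
    s≤s (⊔-lub (cost-send p b f k k≤c) (cost-send p b _ (k ∘ (2 ^ b +_)) (k≤c ∘ (2 ^ b +_))))

  announce : ∀ {m} (p : Party) → ℕ → (Input p → Maybe (Fin m)) → (Maybe (Fin m) → Protocol X Y O) → Protocol X Y O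
  announce p b f k = send p b (encode ∘ f) (k ∘ decode)

  run-announce : ∀ {m} p b f k x y → m < 2 ^ b → run (announce {m} p b f k) x y ≡ run (k (f (input p x y))) x y
  run-announce p b f k x y m<2^b =
    trans (run-send p b (encode ∘ f) (k ∘ decode) x y (≤-<-trans (encode≤m (f (input p x y))) m<2^b))
          (cong (λ z → run (k z) x y) (decode∘encode (f (input p x y))))

  cost-announce : ∀ {m} p b f k {c} → (∀ z → cost (k z) ≤ c) → cost (announce {m} p b f k) ≤ b + c
  cost-announce p b f k k≤c = cost-send p b (encode ∘ f) (k ∘ decode) (k≤c ∘ decode)

-- The estimate `own` of a party's degree has fallen to d by at least half of the slack own + other ∸ k.
HalfDrop : ℕ → ℕ → ℕ → ℕ → Set
HalfDrop k own other d = own + other + 2 * d ≤ k + 2 * own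

halfDrop? : ∀ k own other d → Dec (HalfDrop k own other d)
halfDrop? k own other d = own + other + 2 * d ≤? k + 2 * own

¬HalfDrop⇒< : ∀ {k a b x y} → ¬ HalfDrop k a b x → ¬ HalfDrop k b a y → k < x + y
¬HalfDrop⇒< {k} {a} {b} {x} {y} ¬dx ¬dy = *-cancelˡ-≤ 2 (+-cancelˡ-≤ (2 * (a + b)) _ _ (begin
  2 * (a + b) + 2 * suc k            ≡⟨ regroupˡ a b k ⟩
  suc (k + 2 * a) + suc (k + 2 * b)  ≤⟨ +-mono-≤ (≰⇒> ¬dx) (≰⇒> ¬dy) ⟩
  (a + b + 2 * x) + (b + a + 2 * y)  ≡⟨ regroupʳ a b x y ⟩
  2 * (a + b) + 2 * (x + y)          ∎))
  where
  open ≤-Reasoning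
  regroupˡ : ∀ a b k → 2 * (a + b) + 2 * suc k ≡ suc (k + 2 * a) + suc (k + 2 * b)
  regroupˡ = solve-∀
  regroupʳ : ∀ a b x y → (a + b + 2 * x) + (b + a + 2 * y) ≡ 2 * (a + b) + 2 * (x + y)
  regroupʳ = solve-∀

[d∸k]*2≤e∸k : ∀ {d k e} → 2 * d ≤ k + e → (d ∸ k) * 2 ≤ e ∸ k
[d∸k]*2≤e∸k {d} {k} {e} 2d≤k+e with k ≤? d
... | no  k≰d rewrite m≤n⇒m∸n≡0 (≰⇒≥ k≰d) = z≤n
... | yes k≤d = m+n≤o⇒m≤o∸n _ (+-cancelˡ-≤ k _ _ (begin
  k + ((d ∸ k) * 2 + k)  ≡⟨ regroup k (d ∸ k) ⟩
  2 * (k + (d ∸ k))      ≡⟨ cong (2 *_) (m+[n∸m]≡n k≤d) ⟩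
  2 * d                  ≤⟨ 2d≤k+e ⟩
  k + e                  ∎))
  where
  open ≤-Reasoning
  regroup : ∀ k t → k + (t * 2 + k) ≡ 2 * (k + t)
  regroup = solve-∀

HalfDrop⇒slack-halves : ∀ {k a b x y} → y ≤ b → HalfDrop k a b x → (x + y ∸ k) * 2 ≤ a + b ∸ k
HalfDrop⇒slack-halves {k} {a} {b} {x} {y} y≤b dx = [d∸k]*2≤e∸k {x + y} {k} {a + b} (+-cancelˡ-≤ (a + b) _ _ (begin
  (a + b) + 2 * (x + y)      ≡⟨ regroupˡ a b x y ⟩
  (a + b + 2 * x) + 2 * y    ≤⟨ +-mono-≤ dx (*-monoʳ-≤ 2 y≤b) ⟩
  (k + 2 * a) + 2 * b        ≡⟨ regroupʳ a b k ⟩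
  (a + b) + (k + (a + b))    ∎))
  where
  open ≤-Reasoning
  regroupˡ : ∀ a b x y → (a + b) + 2 * (x + y) ≡ (a + b + 2 * x) + 2 * y
  regroupˡ = solve-∀
  regroupʳ : ∀ a b k → (k + 2 * a) + 2 * b ≡ (a + b) + (k + (a + b))
  regroupʳ = solve-∀

HalfDrop⊎⇒slack-halves : ∀ {k a b x y} → x ≤ a → y ≤ b → HalfDrop k a b x ⊎ HalfDrop k b a y →
                         (x + y ∸ k) * 2 ≤ a + b ∸ k
HalfDrop⊎⇒slack-halves {k} {a} {b} {x} {y} _   y≤b (inj₁ dx) = HalfDrop⇒slack-halves {k} {a} {b} {x} {y} y≤b dx
HalfDrop⊎⇒slack-halves {k} {a} {b} {x} {y} x≤a _   (inj₂ dy) =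
  subst₂ (λ d e → (d ∸ k) * 2 ≤ e ∸ k) (+-comm y x) (+-comm b a) (HalfDrop⇒slack-halves {k} {b} {a} {y} {x} x≤a dy)

n≤2^⌈log₂n⌉ : ∀ n → n ≤ 2 ^ ⌈log₂ n ⌉
n≤2^⌈log₂n⌉ = <-rec _ bound
  where
  bound : ∀ n → (∀ {m} → m < n → m ≤ 2 ^ ⌈log₂ m ⌉) → n ≤ 2 ^ ⌈log₂ n ⌉
  bound zero          _   = z≤n
  bound (suc zero)    _   = s≤s z≤n
  bound n@(suc (suc m)) rec = begin
    n                                ≡⟨ sym (⌊n/2⌋+⌈n/2⌉≡n n) ⟩
    ⌊ n /2⌋ + ⌈ n /2⌉                ≤⟨ +-monoˡ-≤ ⌈ n /2⌉ (⌊n/2⌋≤⌈n/2⌉ n) ⟩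
    ⌈ n /2⌉ + ⌈ n /2⌉                ≡⟨ cong (⌈ n /2⌉ +_) (sym (+-identityʳ ⌈ n /2⌉)) ⟩
    2 * ⌈ n /2⌉                      ≤⟨ *-monoʳ-≤ 2 (rec {⌈ n /2⌉} (⌈n/2⌉<n m)) ⟩
    2 * 2 ^ ⌈log₂ ⌈ n /2⌉ ⌉          ≡⟨ cong (λ e → 2 ^ suc e) (⌈log₂⌈n/2⌉⌉≡⌈log₂n⌉∸1 n) ⟩
    2 ^ suc (⌈log₂ n ⌉ ∸ 1)          ≡⟨ cong (2 ^_) (m+[n∸m]≡n (⌈log₂⌉-mono-≤ {2} {n} (s≤s (s≤s z≤n)))) ⟩
    2 ^ ⌈log₂ n ⌉                    ∎
    where open ≤-Reasoning

-- The peeling protocol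

module Peeling (n : ℕ) where
  open Messages {Graph n} {Graph n} {Output n}

  Proto : Set
  Proto = Protocol (Graph n) (Graph n) (Output n)

  bits : ℕ
  bits = suc ⌈log₂ n ⌉

  n<2^bits : n < 2 ^ bits
  n<2^bits = ≤-<-trans (n≤2^⌈log₂n⌉ n) (^-monoʳ-< 2 (s≤s (s≤s z≤n)) (n<1+n ⌈log₂ n ⌉))

  record State : Set where
    field
      threshold : ℕ
      order     : Permutation′ n
      peeled    : ℕ
      estA estB : Fin n → ℕ
      syncs     : Fin n → ℕ
      core      : Subset n
  open State public

  position : State → Fin n → Fin n
  position st u = order st ⟨$⟩ʳ u

  alive? : ∀ st u → Dec (peeled st ≤ toℕ (position st u))
  alive? st u = peeled st ≤? toℕ (position st u)

  -- The peeled vertices occupy the positions below `peeled`, in the order they were peeled.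
  alive : State → Subset n
  alive st = tabulate (⌊_⌋ ∘ alive? st)

  Removable : State → Fin n → Set
  Removable st v = v ∈ alive st × estA st v + estB st v ≤ threshold st

  removable? : ∀ st v → Dec (Removable st v)
  removable? st v = (v ∈? alive st) ×-dec (estA st v + estB st v ≤? threshold st)

  DropsA : State → Graph n → Fin n → Set
  DropsA st A v = v ∈ alive st × HalfDrop (threshold st) (estA st v) (estB st v) (degIn A (alive st) v)

  DropsB : State → Graph n → Fin n → Set
  DropsB st B v = v ∈ alive st × HalfDrop (threshold st) (estB st v) (estA st v) (degIn B (alive st) v)

  dropsA? : ∀ st A v → Dec (DropsA st A v)
  dropsA? st A v = (v ∈? alive st) ×-dec halfDrop? (threshold st) (estA st v) (estB st v) (degIn A (alive st) v)

  dropsB? : ∀ st B v → Dec (DropsB st B v)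
  dropsB? st B v = (v ∈? alive st) ×-dec halfDrop? (threshold st) (estB st v) (estA st v) (degIn B (alive st) v)

  witness : ∀ {Q : Fin n → Set} → Dec (∃ Q) → Maybe (Fin n)
  witness = Maybe.map proj₁ ∘ dec⇒maybe

  peeled<n : ∀ st {w} → w ∈ alive st → peeled st < n
  peeled<n st w∈ = ≤-<-trans (∈-tabulate-⌊⌋⁻ (alive? st) w∈) (toℕ<n _)

  -- w moves to position `peeled`, swapping places with the vertex there.
  remove : (st : State) (w : Fin n) → w ∈ alive st → State
  remove st w w∈ = record st
    { order  = order st ∘ₚ transpose (position st w) (fromℕ< (peeled<n st w∈))
    ; peeled = suc (peeled st)
    }

  resync : State → Fin n → ℕ → ℕ → State
  resync st v x y = record st
    { estA  = updateAt (estA st) v (const x)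
    ; estB  = updateAt (estB st) v (const y)
    ; syncs = updateAt (syncs st) v suc
    }

  raise : State → State
  raise st = record st { threshold = suc (threshold st) ; core = alive st }

  output : State → Output n
  output st = threshold st , order st , core st

  -- returned only when the fuel runs out, which never happens from the initial state
  junk : Output n
  junk = 0 , idₚ , ⊥

  exchangeDegrees : State → Fin n → (State → Proto) → Proto
  exchangeDegrees st v next =
    send Alice bits (λ A → degIn A (alive st) v) λ x →
    send Bob   bits (λ B → degIn B (alive st) v) λ y →
    next (resync st v x y)

  afterReport : Proto → State → (State → Proto) → Maybe (Fin n) → Proto
  afterReport silent st next nothing  = silent
  afterReport silent st next (just v) = exchangeDegrees st v next

  reportA : State → Graph n → Maybe (Fin n)
  reportA st A = witness (any? (dropsA? st A))

  reportB : State → Graph n → Maybe (Fin n)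
  reportB st B = witness (any? (dropsB? st B))

  bobsTurn : State → (State → Proto) → Proto
  bobsTurn st next = announce Bob bits (reportB st) (afterReport (next (raise st)) st next)

  round : State → (State → Proto) → Proto
  round st next = announce Alice bits (reportA st) (afterReport (bobsTurn st next) st next)

  step′ : ∀ st → (State → Proto) → Dec (Nonempty (alive st)) → Dec (∃ (Removable st)) → Proto
  step′ st next (no _)  _                  = leaf (output st)
  step′ st next (yes _) (yes (w , w∈ , _)) = next (remove st w w∈)
  step′ st next (yes _) (no _)             = round st next

  step : State → (State → Proto) → Proto
  step st next = step′ st next (nonempty? (alive st)) (any? (removable? st))

  protocol : ℕ → State → Proto
  protocol zero    st = leaf junk
  protocol (suc F) st = step st (protocol F)

  initial : State
  initial = record
    { threshold = 0 ; order = idₚ ; peeled = 0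
    ; estA = const n ; estB = const n ; syncs = const 0 ; core = ⊤ }

  roundCost : ℕ
  roundCost = 4 * bits

  module _ {next : State → Proto} {c} (next≤c : ∀ st → cost (next st) ≤ c) where

    cost-exchangeDegrees : ∀ st v → cost (exchangeDegrees st v next) ≤ bits + (bits + c)
    cost-exchangeDegrees st v = cost-send Alice bits _ _ λ x → cost-send Bob bits _ _ λ y → next≤c _

    cost-afterReport : ∀ {silent d} st → cost silent ≤ d → bits + (bits + c) ≤ d →
                       ∀ z → cost (afterReport silent st next z) ≤ d
    cost-afterReport st silent≤d _   nothing  = silent≤d
    cost-afterReport st _        e≤d (just v) = ≤-trans (cost-exchangeDegrees st v) e≤d

    cost-round : ∀ st → cost (round st next) ≤ roundCost + c
    cost-round st = begin
      cost (round st next)                   ≤⟨ cost-announce Alice bits (reportA st) _ (cost-afterReport st bob≤ exchange≤) ⟩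
      bits + (bits + (bits + (bits + c)))    ≡⟨ regroup bits c ⟩
      roundCost + c                          ∎
      where
      open ≤-Reasoning
      bob≤ : cost (bobsTurn st next) ≤ bits + (bits + (bits + c))
      bob≤ = cost-announce Bob bits (reportB st) _
               (cost-afterReport st (≤-trans (next≤c _) (≤-trans (m≤n+m c bits) (m≤n+m (bits + c) bits))) ≤-refl)
      exchange≤ : bits + (bits + c) ≤ bits + (bits + (bits + c))
      exchange≤ = +-monoʳ-≤ bits (+-monoʳ-≤ bits (m≤n+m c bits))
      regroup : ∀ b c → b + (b + (b + (b + c))) ≡ 4 * b + c
      regroup = solve-∀

    cost-step : ∀ st → cost (step st next) ≤ roundCost + c
    cost-step st = by-cases (nonempty? (alive st)) (any? (removable? st))
      where
      by-cases : ∀ d₁ d₂ → cost (step′ st next d₁ d₂) ≤ roundCost + c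
      by-cases (no _)  _                  = z≤n
      by-cases (yes _) (yes (w , w∈ , _)) = ≤-trans (next≤c _) (m≤n+m c roundCost)
      by-cases (yes _) (no _)             = cost-round st

  cost-protocol : ∀ F st → cost (protocol F st) ≤ F * roundCost
  cost-protocol zero    st = z≤n
  cost-protocol (suc F) st = cost-step (cost-protocol F) st


  ∈-alive⁺ : ∀ st {u} → peeled st ≤ toℕ (position st u) → u ∈ alive st
  ∈-alive⁺ st = ∈-tabulate-⌊⌋⁺ (alive? st)

  ∈-alive⁻ : ∀ st {u} → u ∈ alive st → peeled st ≤ toℕ (position st u)
  ∈-alive⁻ st = ∈-tabulate-⌊⌋⁻ (alive? st)

  weightOf : ∀ {Q : Set} → Dec Q → ℕ → ℕ
  weightOf (yes _) c = suc (suc bits ∸ c)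
  weightOf (no _)  _ = 0

  weight : State → Fin n → ℕ
  weight st u = weightOf (u ∈? alive st) (syncs st u)

  potential : State → ℕ
  potential st = sum (weight st) + (n ∸ threshold st)

  weight-mono : ∀ st st′ u → (u ∈ alive st′ → u ∈ alive st) → syncs st u ≤ syncs st′ u → weight st′ u ≤ weight st u
  weight-mono st st′ u alive′⇒alive c≤c′ = by-cases (u ∈? alive st′) (u ∈? alive st)
    where
    by-cases : (d′ : Dec (u ∈ alive st′)) (d : Dec (u ∈ alive st)) → weightOf d′ (syncs st′ u) ≤ weightOf d (syncs st u)
    by-cases (no _)    _       = z≤n
    by-cases (yes _)   (yes _) = s≤s (∸-monoʳ-≤ (suc bits) c≤c′)
    by-cases (yes u∈′) (no u∉) = contradiction (alive′⇒alive u∈′) u∉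

  weight-alive : ∀ st {u} → u ∈ alive st → weight st u ≡ suc (suc bits ∸ syncs st u)
  weight-alive st {u} u∈ = by-cases (u ∈? alive st)
    where
    by-cases : (d : Dec (u ∈ alive st)) → weightOf d (syncs st u) ≡ suc (suc bits ∸ syncs st u)
    by-cases (yes _)  = refl
    by-cases (no u∉) = contradiction u∈ u∉

  weight-dead : ∀ st {u} → u ∉ alive st → weight st u ≡ 0
  weight-dead st {u} u∉ = by-cases (u ∈? alive st)
    where
    by-cases : (d : Dec (u ∈ alive st)) → weightOf d (syncs st u) ≡ 0
    by-cases (yes u∈) = contradiction u∈ u∉
    by-cases (no _)   = refl

  resync-decreases : ∀ st {v} x y → v ∈ alive st → syncs st v < suc bits → potential (resync st v x y) < potential st
  resync-decreases st {v} x y v∈ c<1+bits = +-monoˡ-< (n ∸ threshold st)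
    (sum-mono-< (λ u → weight-mono st st′ u id (syncs≤ u)) v (begin-strict
      weight st′ v                     ≡⟨ weight-alive st′ v∈ ⟩
      suc (suc bits ∸ syncs st′ v)     ≡⟨ cong (λ c → suc (suc bits ∸ c)) (updateAt-updates v (syncs st)) ⟩
      suc (suc bits ∸ suc (syncs st v)) <⟨ s≤s (∸-monoʳ-< (n<1+n (syncs st v)) c<1+bits) ⟩
      suc (suc bits ∸ syncs st v)      ≡⟨ weight-alive st v∈ ⟨
      weight st v                      ∎))
    where
    open ≤-Reasoning
    st′ : State
    st′ = resync st v x y
    syncs≤ : ∀ u → syncs st u ≤ syncs st′ u
    syncs≤ u with u ≟ᶠ v
    ... | yes refl rewrite updateAt-updates u {suc} (syncs st) = n≤1+n _
    ... | no  u≢v  rewrite updateAt-minimal u v {suc} (syncs st) u≢v = ≤-refl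

  raise-decreases : ∀ st → threshold st < n → potential (raise st) < potential st
  raise-decreases st k<n = +-monoʳ-< (sum (weight st)) (∸-monoʳ-< (n<1+n (threshold st)) k<n)

  fuel : ℕ
  fuel = suc (n * suc (suc bits) + n)

  potential-initial : potential initial < fuel
  potential-initial = s≤s (+-monoˡ-≤ n (sum≤m*b λ u → weight≤ (u ∈? alive initial)))
    where
    weight≤ : ∀ {Q : Set} (d : Dec Q) → weightOf d 0 ≤ suc (suc bits)
    weight≤ (yes _) = ≤-refl
    weight≤ (no _)  = z≤n

  fuel*roundCost≤ : 2 ≤ n → fuel * roundCost ≤ 48 * n * ⌈log₂ n ⌉ ^ 3
  fuel*roundCost≤ 2≤n = begin
    suc (n * suc (suc (suc ℓ)) + n) * (4 * suc ℓ)  ≤⟨ *-mono-≤ fuel≤ roundCost≤ ⟩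
    6 * (n * ℓ) * (4 * (ℓ + ℓ))                    ≡⟨ regroup n ℓ ⟩
    48 * n * ℓ ^ 2                                 ≤⟨ *-monoʳ-≤ (48 * n) (^-monoʳ-≤ ℓ {{ℓ≢0}} (n≤1+n 2)) ⟩
    48 * n * ℓ ^ 3                                 ∎
    where
    open ≤-Reasoning
    ℓ : ℕ
    ℓ = ⌈log₂ n ⌉
    1≤ℓ : 1 ≤ ℓ
    1≤ℓ = ⌈log₂⌉-mono-≤ {2} {n} 2≤n
    ℓ≢0 : NonZero ℓ
    ℓ≢0 = >-nonZero 1≤ℓ
    n≤nℓ : n ≤ n * ℓ
    n≤nℓ = m≤m*n n ℓ {{ℓ≢0}}
    1≤nℓ : 1 ≤ n * ℓ
    1≤nℓ = ≤-trans (≤-trans (n≤1+n 1) 2≤n) n≤nℓ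
    fuel≤ : suc (n * suc (suc (suc ℓ)) + n) ≤ 6 * (n * ℓ)
    fuel≤ = begin
      suc (n * suc (suc (suc ℓ)) + n)   ≡⟨ unfold n ℓ ⟩
      n * ℓ + 4 * n + 1                 ≤⟨ +-mono-≤ (+-monoʳ-≤ (n * ℓ) (*-monoʳ-≤ 4 n≤nℓ)) 1≤nℓ ⟩
      n * ℓ + 4 * (n * ℓ) + n * ℓ       ≡⟨ collect (n * ℓ) ⟩
      6 * (n * ℓ)                       ∎
      where
      unfold : ∀ n ℓ → suc (n * suc (suc (suc ℓ)) + n) ≡ n * ℓ + 4 * n + 1
      unfold = solve-∀
      collect : ∀ m → m + 4 * m + m ≡ 6 * m
      collect = solve-∀
    roundCost≤ : 4 * suc ℓ ≤ 4 * (ℓ + ℓ)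
    roundCost≤ = *-monoʳ-≤ 4 (+-monoˡ-≤ ℓ 1≤ℓ)
    regroup : ∀ n ℓ → 6 * (n * ℓ) * (4 * (ℓ + ℓ)) ≡ 48 * n * (ℓ * (ℓ * 1))
    regroup = solve-∀

  module Removal (st : State) {w} (w∈ : w ∈ alive st) where

    r : ℕ
    r = peeled st

    p q : Fin n
    p = position st w
    q = fromℕ< (peeled<n st w∈)

    st′ : State
    st′ = remove st w w∈

    toℕq≡r : toℕ q ≡ r
    toℕq≡r = toℕ-fromℕ< (peeled<n st w∈)

    r≤p : r ≤ toℕ p
    r≤p = ∈-alive⁻ st w∈

    r≤q : r ≤ toℕ q
    r≤q = ≤-reflexive (sym toℕq≡r)

    position′-w : position st′ w ≡ q
    position′-w = transpose-i p q

    w∉alive′ : w ∉ alive st′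
    w∉alive′ w∈′ = <-irrefl (sym toℕq≡r) (subst (λ i → r < toℕ i) position′-w (∈-alive⁻ st′ w∈′))

    alive′⊆alive : alive st′ ⊆ alive st
    alive′⊆alive {u} u∈′ = ∈-alive⁺ st (by-cases (position st u ≟ᶠ p) (position st u ≟ᶠ q))
      where
      r<τu : r < toℕ (PC.transpose p q (position st u))
      r<τu = ∈-alive⁻ st′ u∈′
      by-cases : Dec (position st u ≡ p) → Dec (position st u ≡ q) → r ≤ toℕ (position st u)
      by-cases (yes πu≡p) _          = subst (λ i → r ≤ toℕ i) (sym πu≡p) r≤p
      by-cases (no _)     (yes πu≡q) = subst (λ i → r ≤ toℕ i) (sym πu≡q) r≤q
      by-cases (no πu≢p)  (no πu≢q)  = <⇒≤ (subst (λ i → r < toℕ i) (transpose-fixes p q πu≢p πu≢q) r<τu)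

    alive⊆alive′ : ∀ {u} → u ∈ alive st → u ≢ w → u ∈ alive st′
    alive⊆alive′ {u} u∈ u≢w = ∈-alive⁺ st′ (by-cases (position st u ≟ᶠ q))
      where
      πu≢p : position st u ≢ p
      πu≢p = u≢w ∘ ⟨$⟩ʳ-injective (order st)
      position≢r : ∀ {i} → i ≢ q → toℕ i ≢ r
      position≢r i≢q i≡r = i≢q (toℕ-injective (trans i≡r (sym toℕq≡r)))
      by-cases : Dec (position st u ≡ q) → r < toℕ (PC.transpose p q (position st u))
      by-cases (yes πu≡q) rewrite πu≡q | transpose-j p q =
        ≤∧≢⇒< r≤p (position≢r (πu≢p ∘ trans πu≡q ∘ sym) ∘ sym)
      by-cases (no  πu≢q) rewrite transpose-fixes p q πu≢p πu≢q =
        ≤∧≢⇒< (∈-alive⁻ st u∈) (position≢r πu≢q ∘ sym)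

    peeled-below : ∀ {v} → v ∉ alive st → toℕ (position st v) < r
    peeled-below v∉ = ≰⇒> (v∉ ∘ ∈-alive⁺ st)

    position′-peeled : ∀ {v} → v ∉ alive st → position st′ v ≡ position st v
    position′-peeled {v} v∉ = transpose-fixes p q (differs r≤p) (differs r≤q)
      where
      differs : ∀ {i} → r ≤ toℕ i → position st v ≢ i
      differs r≤i refl = <⇒≱ (peeled-below v∉) r≤i

    <?-position′ : ∀ {v} → v ∉ alive st → ∀ u →
                   ⌊ position st′ v <? position st′ u ⌋ ≡ ⌊ position st v <? position st u ⌋
    <?-position′ {v} v∉ u rewrite position′-peeled v∉ =
      <?-transpose p q (<-≤-trans (peeled-below v∉) r≤p) (<-≤-trans (peeled-below v∉) r≤q) (position st u)

    decreases : potential st′ < potential st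
    decreases = +-monoˡ-< (n ∸ threshold st)
      (sum-mono-< (λ u → weight-mono st st′ u alive′⊆alive ≤-refl) w
        (subst (_< weight st w) (sym (weight-dead st′ w∉alive′)) (subst (0 <_) (sym (weight-alive st w∈)) z<s)))

-- Correctness

module Correctness {n} (A B : Graph n) (disjoint : Disjoint A B) where
  open Peeling n
  open Messages {Graph n} {Graph n} {Output n}

  G : Graph n
  G = A ∪G B

  record Invariant (st : State) : Set where
    field
      estA-bound    : ∀ {v} → v ∈ alive st → degIn A (alive st) v ≤ estA st v
      estB-bound    : ∀ {v} → v ∈ alive st → degIn B (alive st) v ≤ estB st v
      slack-bound   : ∀ {v} → v ∈ alive st → (estA st v + estB st v ∸ threshold st) * 2 ^ syncs st v ≤ 2 * n
      peeled-odeg   : ∀ {v} → v ∉ alive st → odeg G (order st) v ≤ threshold st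
      core-dense    : MinDegAtLeast G (threshold st) (core st)
      core-maximum  : ∀ T → MinDegAtLeast G (threshold st) T → T ⊆ core st
      dense⊆alive   : ∀ T → MinDegAtLeast G (suc (threshold st)) T → T ⊆ alive st
      core-nonempty : threshold st ≡ 0 ⊎ Nonempty (core st)

  initial-invariant : Invariant initial
  initial-invariant = record
    { estA-bound    = λ {v} _ → degIn≤n A (alive initial) v
    ; estB-bound    = λ {v} _ → degIn≤n B (alive initial) v
    ; slack-bound   = λ _ → ≤-reflexive (trans (*-identityʳ (n + n)) (cong (n +_) (sym (+-identityʳ n))))
    ; peeled-odeg   = λ v∉ → contradiction all-alive v∉
    ; core-dense    = λ _ _ → z≤n
    ; core-maximum  = λ _ _ → ⊆⊤
    ; dense⊆alive   = λ _ _ _ → all-alive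
    ; core-nonempty = inj₁ refl
    }
    where
    all-alive : ∀ {u} → u ∈ alive initial
    all-alive = ∈-alive⁺ initial z≤n

  module _ {st} (I : Invariant st) where
    open Invariant I

    degG≤est : ∀ {v} → v ∈ alive st → degIn G (alive st) v ≤ estA st v + estB st v
    degG≤est {v} v∈ = subst (_≤ estA st v + estB st v) (sym (degIn-∪G {A = A} {B} disjoint (alive st) v))
                            (+-mono-≤ (estA-bound v∈) (estB-bound v∈))

    syncs<1+bits : ∀ {v} → v ∈ alive st → threshold st < estA st v + estB st v → syncs st v < suc bits
    syncs<1+bits {v} v∈ k<e = ≰⇒> λ 1+bits≤c → <⇒≱ (2n<2^c 1+bits≤c) (begin
      2 ^ syncs st v          ≤⟨ m≤n*m (2 ^ syncs st v) t {{>-nonZero (m<n⇒0<n∸m k<e)}} ⟩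
      t * 2 ^ syncs st v      ≤⟨ slack-bound v∈ ⟩
      2 * n                   ∎)
      where
      open ≤-Reasoning
      t : ℕ
      t = estA st v + estB st v ∸ threshold st
      2n<2^c : suc bits ≤ syncs st v → 2 * n < 2 ^ syncs st v
      2n<2^c 1+bits≤c = <-≤-trans (*-monoʳ-< 2 n<2^bits) (^-monoʳ-≤ 2 1+bits≤c)

    output-correct : Empty (alive st) → Correct n A B (output st)
    output-correct none-alive = proj₁ certificate , ordering , proj₂ certificate
      where
      certificate : IsDegeneracy G (threshold st) × IsCore G (threshold st) (core st)
      certificate = degeneracy-certificate G core-dense core-maximum
                      (λ T T-dense (u , u∈T) → none-alive (u , dense⊆alive T T-dense u∈T)) core-nonempty
      ordering : IsKOrdering G (threshold st) (order st)
      ordering v = peeled-odeg λ v∈ → none-alive (v , v∈)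

    remove-invariant : ∀ {w} (w∈ : w ∈ alive st) → estA st w + estB st w ≤ threshold st → Invariant (remove st w w∈)
    remove-invariant {w} w∈ low = record
      { estA-bound    = λ v∈′ → ≤-trans (degIn-mono A alive′⊆alive _) (estA-bound (alive′⊆alive v∈′))
      ; estB-bound    = λ v∈′ → ≤-trans (degIn-mono B alive′⊆alive _) (estB-bound (alive′⊆alive v∈′))
      ; slack-bound   = slack-bound ∘ alive′⊆alive
      ; peeled-odeg   = peeled-odeg′
      ; core-dense    = core-dense
      ; core-maximum  = core-maximum
      ; dense⊆alive   = dense⊆alive′
      ; core-nonempty = core-nonempty
      }
      where
      open Removal st w∈

      degG-w≤k : degIn G (alive st) w ≤ threshold st
      degG-w≤k = ≤-trans (degG≤est w∈) low

      dense⊆alive′ : ∀ T → MinDegAtLeast G (suc (threshold st)) T → T ⊆ alive st′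
      dense⊆alive′ T T-dense u∈T = alive⊆alive′ (dense⊆alive T T-dense u∈T) λ { refl →
        lowDegree∉dense G T-dense (dense⊆alive T T-dense) degG-w≤k u∈T }

      odeg-w≤degG-w : odeg G (order st′) w ≤ degIn G (alive st) w
      odeg-w≤degG-w = p⊆q⇒∣p∣≤∣q∣ λ {u} u∈ →
        let later = ∈-tabulate⁻ u∈
            w<u = ⌊⌋≡true⁻ (position st′ w <? position st′ u) (∧-conicalʳ _ _ later)
        in x∈p∩q⁺ ( alive′⊆alive (∈-alive⁺ st′ (subst (λ t → suc t ≤ toℕ (position st′ u))
                                                      (trans (cong toℕ position′-w) toℕq≡r) w<u))
                  , ∈-tabulate⁺ (∧-conicalˡ _ _ later))

      odeg-unchanged : ∀ {v} → v ∉ alive st → odeg G (order st′) v ≡ odeg G (order st) v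
      odeg-unchanged {v} v∉ = cong ∣_∣ (tabulate-cong λ u → cong (adj G v u ∧_) (<?-position′ v∉ u))

      peeled-odeg′ : ∀ {v} → v ∉ alive st′ → odeg G (order st′) v ≤ threshold st
      peeled-odeg′ {v} v∉′ with v ≟ᶠ w
      ... | yes refl = ≤-trans odeg-w≤degG-w degG-w≤k
      ... | no  v≢w  = subst (_≤ threshold st) (sym (odeg-unchanged v∉)) (peeled-odeg v∉)
        where
        v∉ : v ∉ alive st
        v∉ v∈ = v∉′ (alive⊆alive′ v∈ v≢w)

    resync-invariant : ∀ {v} → v ∈ alive st →
      HalfDrop (threshold st) (estA st v) (estB st v) (degIn A (alive st) v) ⊎
      HalfDrop (threshold st) (estB st v) (estA st v) (degIn B (alive st) v) →
      Invariant (resync st v (degIn A (alive st) v) (degIn B (alive st) v))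
    resync-invariant {v} v∈ drop = record
      { estA-bound    = λ u∈ → estimate-bound (estA st) (degIn A (alive st)) λ _ → estA-bound u∈
      ; estB-bound    = λ u∈ → estimate-bound (estB st) (degIn B (alive st)) λ _ → estB-bound u∈
      ; slack-bound   = slack-bound′
      ; peeled-odeg   = peeled-odeg
      ; core-dense    = core-dense
      ; core-maximum  = core-maximum
      ; dense⊆alive   = dense⊆alive
      ; core-nonempty = core-nonempty
      }
      where
      k x y : ℕ
      k = threshold st
      x = degIn A (alive st) v
      y = degIn B (alive st) v

      st′ : State
      st′ = resync st v x y

      estimate-bound : ∀ (est deg : Fin n → ℕ) {u} → (u ≢ v → deg u ≤ est u) → deg u ≤ updateAt est v (const (deg v)) u
      estimate-bound est deg {u} old with u ≟ᶠ v
      ... | yes refl rewrite updateAt-updates u {const (deg u)} est = ≤-refl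
      ... | no  u≢v  rewrite updateAt-minimal u v {const (deg v)} est u≢v = old u≢v

      slack-bound′ : ∀ {u} → u ∈ alive st → (estA st′ u + estB st′ u ∸ k) * 2 ^ syncs st′ u ≤ 2 * n
      slack-bound′ {u} u∈ with u ≟ᶠ v
      ... | no u≢v rewrite updateAt-minimal u v {const x} (estA st) u≢v | updateAt-minimal u v {const y} (estB st) u≢v
                         | updateAt-minimal u v {suc} (syncs st) u≢v = slack-bound u∈
      ... | yes refl rewrite updateAt-updates u {const x} (estA st) | updateAt-updates u {const y} (estB st)
                           | updateAt-updates u {suc} (syncs st) = begin
        (x + y ∸ k) * (2 * 2 ^ syncs st u)         ≡⟨ *-assoc (x + y ∸ k) 2 (2 ^ syncs st u) ⟨
        (x + y ∸ k) * 2 * 2 ^ syncs st u           ≤⟨ *-monoˡ-≤ (2 ^ syncs st u) halved ⟩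
        (estA st u + estB st u ∸ k) * 2 ^ syncs st u ≤⟨ slack-bound u∈ ⟩
        2 * n                                      ∎
        where
        open ≤-Reasoning
        halved : (x + y ∸ k) * 2 ≤ estA st u + estB st u ∸ k
        halved = HalfDrop⊎⇒slack-halves {k} (estA-bound v∈) (estB-bound v∈) drop

    raise-invariant : Nonempty (alive st) → MinDegAtLeast G (suc (threshold st)) (alive st) → Invariant (raise st)
    raise-invariant alive≢∅ alive-dense = record
      { estA-bound    = estA-bound
      ; estB-bound    = estB-bound
      ; slack-bound   = λ {v} v∈ → ≤-trans (*-monoˡ-≤ (2 ^ syncs st v) (∸-monoʳ-≤ (estA st v + estB st v) (n≤1+n _)))
                                           (slack-bound v∈)
      ; peeled-odeg   = m≤n⇒m≤1+n ∘ peeled-odeg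
      ; core-dense    = alive-dense
      ; core-maximum  = dense⊆alive
      ; dense⊆alive   = λ T → dense⊆alive T ∘ MinDegAtLeast-weaken G (n≤1+n _)
      ; core-nonempty = inj₂ alive≢∅
      }

  Good : Proto → Set
  Good prot = Correct n A B (run prot A B)

  Continues : State → (State → Proto) → Set
  Continues st next = ∀ st′ → Invariant st′ → potential st′ < potential st → Good (next st′)

  module _ {st next} (I : Invariant st) (continues : Continues st next) where
    open Invariant I

    exchangeDegrees-correct : ∀ {v} → v ∈ alive st → threshold st < estA st v + estB st v →
      HalfDrop (threshold st) (estA st v) (estB st v) (degIn A (alive st) v) ⊎
      HalfDrop (threshold st) (estB st v) (estA st v) (degIn B (alive st) v) →
      Good (exchangeDegrees st v next)
    exchangeDegrees-correct {v} v∈ k<e drop = subst (Correct n A B) (sym exchanged)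
      (continues _ (resync-invariant I v∈ drop) (resync-decreases st x y v∈ (syncs<1+bits I v∈ k<e)))
      where
      x y : ℕ
      x = degIn A (alive st) v
      y = degIn B (alive st) v
      exchanged : run (exchangeDegrees st v next) A B ≡ run (next (resync st v x y)) A B
      exchanged = trans (run-send Alice bits _ _ A B (≤-<-trans (degIn≤n A (alive st) v) n<2^bits))
                        (run-send Bob bits _ _ A B (≤-<-trans (degIn≤n B (alive st) v) n<2^bits))

    round-correct : Nonempty (alive st) → ¬ ∃ (Removable st) → Good (round st next)
    round-correct (u , u∈) none-removable =
      subst (Correct n A B) (sym (run-announce Alice bits (reportA st) (afterReport (bobsTurn st next) st next) A B n<2^bits))
            (afterAlice (any? (dropsA? st A)))
      where
      k<e : ∀ {v} → v ∈ alive st → threshold st < estA st v + estB st v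
      k<e v∈ = ≰⇒> λ low → none-removable (_ , v∈ , low)

      afterBob : ¬ ∃ (DropsA st A) → (d : Dec (∃ (DropsB st B))) → Good (afterReport (next (raise st)) st next (witness d))
      afterBob _ (yes (v , v∈ , dropB)) = exchangeDegrees-correct v∈ (k<e v∈) (inj₂ dropB)
      afterBob none-dropA (no none-dropB) =
        continues (raise st) (raise-invariant I (u , u∈) alive-dense)
                  (raise-decreases st (<-≤-trans (alive-dense u u∈) (degIn≤n G (alive st) u)))
        where
        alive-dense : MinDegAtLeast G (suc (threshold st)) (alive st)
        alive-dense v v∈ = subst (threshold st <_) (sym (degIn-∪G {A = A} {B} disjoint (alive st) v))
          (¬HalfDrop⇒< {threshold st} {estA st v} {estB st v} {degIn A (alive st) v} {degIn B (alive st) v}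
                        (λ dA → none-dropA (v , v∈ , dA)) (λ dB → none-dropB (v , v∈ , dB)))

      afterAlice : (d : Dec (∃ (DropsA st A))) → Good (afterReport (bobsTurn st next) st next (witness d))
      afterAlice (yes (v , v∈ , dropA)) = exchangeDegrees-correct v∈ (k<e v∈) (inj₁ dropA)
      afterAlice (no none-dropA) = subst (Correct n A B)
                                         (sym (run-announce Bob bits (reportB st) (afterReport (next (raise st)) st next) A B n<2^bits))
                                         (afterBob none-dropA (any? (dropsB? st B)))

    step-correct : Good (step st next)
    step-correct = by-cases (nonempty? (alive st)) (any? (removable? st))
      where
      by-cases : ∀ d₁ d₂ → Good (step′ st next d₁ d₂)
      by-cases (no none-alive) _ = output-correct I none-alive
      by-cases (yes _) (yes (w , w∈ , low)) = continues _ (remove-invariant I w∈ low) (Removal.decreases st w∈)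
      by-cases (yes alive≢∅) (no none-removable) = round-correct alive≢∅ none-removable

  protocol-correct : ∀ F st → Invariant st → potential st < F → Good (protocol F st)
  protocol-correct zero    st I ()
  protocol-correct (suc F) st I Φ<1+F =
    step-correct I λ st′ I′ Φ′<Φ → protocol-correct F st′ I′ (<-≤-trans Φ′<Φ (s≤s⁻¹ Φ<1+F))

theorem6p1 : Σ ((n : ℕ) → Protocol (Graph n) (Graph n) (Output n)) λ P →
    (∃ λ C → ∃ λ N → ∀ n → N ≤ n → cost (P n) ≤ C * n * (⌈log₂ n ⌉ ^ 3))
    × (∀ n (A B : Graph n) → Disjoint A B → Correct n A B (run (P n) A B))
theorem6p1 = (λ n → protocol n (fuel n) (initial n)) , (48 , 2 , cost-bound) , correct
  where
  open Peeling using (protocol; fuel; initial; cost-protocol; fuel*roundCost≤; potential-initial)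

  cost-bound : ∀ n → 2 ≤ n → cost (protocol n (fuel n) (initial n)) ≤ 48 * n * (⌈log₂ n ⌉ ^ 3)
  cost-bound n 2≤n = ≤-trans (cost-protocol n (fuel n) (initial n)) (fuel*roundCost≤ n 2≤n)

  correct : ∀ n (A B : Graph n) → Disjoint A B → Correct n A B (run (protocol n (fuel n) (initial n)) A B)
  correct n A B disjoint = protocol-correct (fuel n) (initial n) initial-invariant (potential-initial n)
    where open Correctness A B disjoint
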